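{- If $P=P_n(\{z_I\})$ is a generalized permutahedron lying in the nonnegative orthant, then for every $0\le q\le1$ its $q$-lifting $P(q)$ is a generalized permutahedron in $\mathbb{R}^{n+1}$.
   Context: For real numbers $z_I$ ($I\subseteq[n]$, $z_\emptyset=0$) let $P_n(\{z_I\})=\{t\in\mathbb{R}^n:\sum_{i=1}^n t_i=z_{[n]},\ \sum_{i\in I}t_i\ge z_I\ \forall I\subseteq[n]\}$. A generalized permutahedron is a polytope $P_n(\{z_I\})$ whose parameters are supermodular: $z_I+z_J\le z_{I\cup J}+z_{I\cap J}$ for all $I,J\subseteq[n]$. When $P$ lies in the nonnegative orthant, the parameters satisfy $z_I\ge0$ and $z_I\le z_J$ for $I\subseteq J$. For $0\le q\le1$ the $q$-lifting of $P$ is $P(q)=P_{n+1}(\{z'_I\})\subset\mathbb{R}^{n+1}$ where $z'_J=qz_J$ and $z'_{J\cup\{n+1\}}=z_J$ for $J\subseteq[n]$. -}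

module Defs where

open import Level using (Level; _⊔_) renaming (suc to lsuc)
open import Data.Nat using (ℕ; zero; suc)
open import Data.Product using (_×_)
open import Data.Vec using (Vec; []; _∷_)
open import Data.Fin.Subset using (Subset; Side; inside; outside; _∪_; _∩_; _⊆_; ⊥)
open import Relation.Binary.Core using (Rel)
open import Relation.Binary.Structures using (IsTotalOrder)
open import Algebra.Bundles using (CommutativeRing)

-- An ordered commutative ring (e.g. ℝ, ℚ).  The theorem is stated for every
-- such ring; ℝ is the instance of interest in the paper.
record OrderedCommutativeRing (c ℓ₁ ℓ₂ : Level) : Set (lsuc (c ⊔ ℓ₁ ⊔ ℓ₂)) where
  field
    commutativeRing : CommutativeRing c ℓ₁
  open CommutativeRing commutativeRing public
  infix 4 _≤_
  field
    _≤_          : Rel Carrier ℓ₂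
    isTotalOrder : IsTotalOrder _≈_ _≤_
    +-monoˡ-≤    : ∀ {a b} c → a ≤ b → a + c ≤ b + c
    *-nonneg     : ∀ {a b} → 0# ≤ a → 0# ≤ b → 0# ≤ a * b

module _ {c ℓ₁ ℓ₂ : Level} (R : OrderedCommutativeRing c ℓ₁ ℓ₂) where
  open OrderedCommutativeRing R

  Params : ℕ → Set c
  Params n = Subset n → Carrier

  IsGenPermParams : (n : ℕ) → Params n → Set (ℓ₁ ⊔ ℓ₂)
  IsGenPermParams n z =
    (z ⊥ ≈ 0#) × (∀ (I J : Subset n) → z I + z J ≤ z (I ∪ J) + z (I ∩ J))

  NonnegOrthantParams : (n : ℕ) → Params n → Set ℓ₂
  NonnegOrthantParams n z =
    (∀ (I : Subset n) → 0# ≤ z I) × (∀ (I J : Subset n) → I ⊆ J → z I ≤ z J)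

-- Subsets of [n+1]: the last coordinate is the element n+1.
lastS : {n : ℕ} → Subset (suc n) → Side
lastS (x ∷ []) = x
lastS (x ∷ y ∷ ys) = lastS (y ∷ ys)

initS : {n : ℕ} → Subset (suc n) → Subset n
initS (x ∷ []) = []
initS (x ∷ y ∷ ys) = x ∷ initS (y ∷ ys)

liftParams : {c ℓ₁ ℓ₂ : Level} (R : OrderedCommutativeRing c ℓ₁ ℓ₂) {n : ℕ} →
             OrderedCommutativeRing.Carrier R → Params R n → Params R (suc n)
liftParams R q z J with lastS J
... | inside  = z (initS J)
... | outside = OrderedCommutativeRing._*_ R q (z (initS J))

-- Supermodularity of z' splits into four cases according to whether n+1
-- lies in I and J.  If it lies in both, this is supermodularity of z; if in
-- neither, it is that inequality multiplied by q ≥ 0.  In the mixed case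
-- n+1 ∈ I, n+1 ∉ J one subtracts (1 − q)(z_J − z_{I∩J}) ≥ 0 from
-- z_I + z_J ≤ z_{I∪J} + z_{I∩J}; this is where q ≤ 1 and monotonicity of z
-- enter.
module Submission where

open import Defs
open import Level using (Level)
open import Data.Bool using (true; false; _∨_; _∧_)
open import Data.Nat using (ℕ; zero; suc)
open import Data.Product using (_,_)
open import Data.Vec using ([]; _∷_)
open import Data.Fin.Subset using (Subset; Side; inside; outside; _∪_; _∩_; ⊥)
open import Data.Fin.Subset.Properties using (p∩q⊆p; p∩q⊆q)
open import Relation.Binary.PropositionalEquality using (_≡_; refl; cong)
open import Relation.Binary.Bundles using (Poset)
open import Relation.Binary.Structures using (IsTotalOrder)
import Algebra.Properties.Group as GroupProperties
import Relation.Binary.Reasoning.PartialOrder as ≤-Reasoning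

lastS-∪ : ∀ {n} (I J : Subset (suc n)) → lastS (I ∪ J) ≡ lastS I ∨ lastS J
lastS-∪ {zero}  (x ∷ [])     (y ∷ [])      = refl
lastS-∪ {suc n} (_ ∷ x ∷ I) (_ ∷ y ∷ J) = lastS-∪ (x ∷ I) (y ∷ J)

lastS-∩ : ∀ {n} (I J : Subset (suc n)) → lastS (I ∩ J) ≡ lastS I ∧ lastS J
lastS-∩ {zero}  (x ∷ [])     (y ∷ [])      = refl
lastS-∩ {suc n} (_ ∷ x ∷ I) (_ ∷ y ∷ J) = lastS-∩ (x ∷ I) (y ∷ J)

lastS-⊥ : ∀ n → lastS (⊥ {suc n}) ≡ outside
lastS-⊥ zero    = refl
lastS-⊥ (suc n) = lastS-⊥ n

initS-∪ : ∀ {n} (I J : Subset (suc n)) → initS (I ∪ J) ≡ initS I ∪ initS J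
initS-∪ {zero}  (x ∷ [])     (y ∷ [])      = refl
initS-∪ {suc n} (x ∷ x′ ∷ I) (y ∷ y′ ∷ J) = cong ((x ∨ y) ∷_) (initS-∪ (x′ ∷ I) (y′ ∷ J))

initS-∩ : ∀ {n} (I J : Subset (suc n)) → initS (I ∩ J) ≡ initS I ∩ initS J
initS-∩ {zero}  (x ∷ [])     (y ∷ [])      = refl
initS-∩ {suc n} (x ∷ x′ ∷ I) (y ∷ y′ ∷ J) = cong ((x ∧ y) ∷_) (initS-∩ (x′ ∷ I) (y′ ∷ J))

initS-⊥ : ∀ n → initS (⊥ {suc n}) ≡ ⊥
initS-⊥ zero    = refl
initS-⊥ (suc n) = cong (outside ∷_) (initS-⊥ n)

module OrderedCommutativeRingProperties
  {c ℓ₁ ℓ₂ : Level} (R : OrderedCommutativeRing c ℓ₁ ℓ₂) where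

  open OrderedCommutativeRing R
  open GroupProperties +-group using (//-rightDividesˡ; //-rightDividesʳ)

  poset : Poset c ℓ₁ ℓ₂
  poset = record { isPartialOrder = IsTotalOrder.isPartialOrder isTotalOrder }

  open ≤-Reasoning poset

  x≤y⇒0≤y-x : ∀ {x y} → x ≤ y → 0# ≤ y - x
  x≤y⇒0≤y-x {x} {y} x≤y = begin
    0#     ≈⟨ -‿inverseʳ x ⟨
    x - x  ≤⟨ +-monoˡ-≤ (- x) x≤y ⟩
    y - x  ∎

  +-cancelʳ-≤ : ∀ {x y} z → x + z ≤ y + z → x ≤ y
  +-cancelʳ-≤ {x} {y} z x+z≤y+z = begin
    x          ≈⟨ //-rightDividesʳ z x ⟨
    x + z - z  ≤⟨ +-monoˡ-≤ (- z) x+z≤y+z ⟩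
    y + z - z  ≈⟨ //-rightDividesʳ z y ⟩
    y          ∎

  +-monoʳ-≤ : ∀ {x y} z → x ≤ y → z + x ≤ z + y
  +-monoʳ-≤ {x} {y} z x≤y = begin
    z + x  ≈⟨ +-comm z x ⟩
    x + z  ≤⟨ +-monoˡ-≤ z x≤y ⟩
    y + z  ≈⟨ +-comm y z ⟩
    z + y  ∎

  *-monoʳ-≤-nonNeg : ∀ {x y z} → 0# ≤ z → x ≤ y → z * x ≤ z * y
  *-monoʳ-≤-nonNeg {x} {y} {z} 0≤z x≤y = begin
    z * x                ≈⟨ +-identityˡ (z * x) ⟨
    0# + z * x           ≤⟨ +-monoˡ-≤ (z * x) (*-nonneg 0≤z (x≤y⇒0≤y-x x≤y)) ⟩
    z * (y - x) + z * x  ≈⟨ distribˡ z (y - x) x ⟨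
    z * (y - x + x)      ≈⟨ *-congˡ (//-rightDividesˡ x y) ⟩
    z * y                ∎

  *-monoˡ-≤-nonNeg : ∀ {x y z} → 0# ≤ z → x ≤ y → x * z ≤ y * z
  *-monoˡ-≤-nonNeg {x} {y} {z} 0≤z x≤y = begin
    x * z  ≈⟨ *-comm x z ⟩
    z * x  ≤⟨ *-monoʳ-≤-nonNeg 0≤z x≤y ⟩
    z * y  ≈⟨ *-comm z y ⟩
    y * z  ∎

  q≤1⇒q*x≤x : ∀ {q x} → q ≤ 1# → 0# ≤ x → q * x ≤ x
  q≤1⇒q*x≤x {q} {x} q≤1 0≤x = begin
    q * x   ≤⟨ *-monoˡ-≤-nonNeg 0≤x q≤1 ⟩
    1# * x  ≈⟨ *-identityˡ x ⟩
    x       ∎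

  x+y≤u+v⇒qx+qy≤qu+qv : ∀ {q x y u v} → 0# ≤ q → x + y ≤ u + v →
                        q * x + q * y ≤ q * u + q * v
  x+y≤u+v⇒qx+qy≤qu+qv {q} {x} {y} {u} {v} 0≤q x+y≤u+v = begin
    q * x + q * y  ≈⟨ distribˡ q x y ⟨
    q * (x + y)    ≤⟨ *-monoʳ-≤-nonNeg 0≤q x+y≤u+v ⟩
    q * (u + v)    ≈⟨ distribˡ q u v ⟩
    q * u + q * v  ∎

  -- With d = y − v ≥ 0 the hypothesis reads x + d ≤ u, and q * d ≤ d.
  x+y≤u+v⇒x+qy≤u+qv : ∀ {q x y u v} → q ≤ 1# → v ≤ y → x + y ≤ u + v →
                      x + q * y ≤ u + q * v
  x+y≤u+v⇒x+qy≤u+qv {q} {x} {y} {u} {v} q≤1 v≤y x+y≤u+v = begin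
    x + q * y              ≈⟨ +-congˡ (*-congˡ (//-rightDividesˡ v y)) ⟨
    x + q * (d + v)        ≈⟨ +-congˡ (distribˡ q d v) ⟩
    x + (q * d + q * v)    ≈⟨ +-assoc x (q * d) (q * v) ⟨
    x + q * d + q * v      ≤⟨ +-monoˡ-≤ (q * v) x+qd≤u ⟩
    u + q * v              ∎
    where
    d : Carrier
    d = y - v

    x+d≤u : x + d ≤ u
    x+d≤u = +-cancelʳ-≤ v (begin
      x + d + v    ≈⟨ +-assoc x d v ⟩
      x + (d + v)  ≈⟨ +-congˡ (//-rightDividesˡ v y) ⟩
      x + y        ≤⟨ x+y≤u+v ⟩
      u + v        ∎)

    x+qd≤u : x + q * d ≤ u
    x+qd≤u = begin
      x + q * d  ≤⟨ +-monoʳ-≤ x (q≤1⇒q*x≤x q≤1 (x≤y⇒0≤y-x v≤y)) ⟩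
      x + d      ≤⟨ x+d≤u ⟩
      u          ∎

module Lifting {c ℓ₁ ℓ₂ : Level} (R : OrderedCommutativeRing c ℓ₁ ℓ₂) where

  open OrderedCommutativeRing R hiding (refl)
  open OrderedCommutativeRingProperties R
  open ≤-Reasoning poset

  scaleBy : Carrier → Side → Carrier → Carrier
  scaleBy q inside  x = x
  scaleBy q outside x = q * x

  liftParams≡scaleBy : ∀ {n} q (z : Params R n) (J : Subset (suc n)) →
                       liftParams R q z J ≡ scaleBy q (lastS J) (z (initS J))
  liftParams≡scaleBy q z J with lastS J
  ... | inside  = refl
  ... | outside = refl

  scaleBy-supermodular : ∀ {q x y u v} → 0# ≤ q → q ≤ 1# →
                         x + y ≤ u + v → v ≤ x → v ≤ y → ∀ s t →
                         scaleBy q s x + scaleBy q t y ≤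
                         scaleBy q (s ∨ t) u + scaleBy q (s ∧ t) v
  scaleBy-supermodular 0≤q q≤1 x+y≤u+v v≤x v≤y true  true  = x+y≤u+v
  scaleBy-supermodular 0≤q q≤1 x+y≤u+v v≤x v≤y true  false =
    x+y≤u+v⇒x+qy≤u+qv q≤1 v≤y x+y≤u+v
  scaleBy-supermodular {q} {x} {y} {u} {v} 0≤q q≤1 x+y≤u+v v≤x v≤y false true = begin
    q * x + y  ≈⟨ +-comm (q * x) y ⟩
    y + q * x  ≤⟨ x+y≤u+v⇒x+qy≤u+qv q≤1 v≤x y+x≤u+v ⟩
    u + q * v  ∎
    where
    y+x≤u+v : y + x ≤ u + v
    y+x≤u+v = begin
      y + x  ≈⟨ +-comm y x ⟩
      x + y  ≤⟨ x+y≤u+v ⟩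
      u + v  ∎
  scaleBy-supermodular 0≤q q≤1 x+y≤u+v v≤x v≤y false false =
    x+y≤u+v⇒qx+qy≤qu+qv 0≤q x+y≤u+v

open Lifting

proposition2p4 : {c ℓ₁ ℓ₂ : Level} (R : OrderedCommutativeRing c ℓ₁ ℓ₂) (n : ℕ)
    (z : Params R n) →
    IsGenPermParams R n z →
    NonnegOrthantParams R n z →
    (q : OrderedCommutativeRing.Carrier R) →
    OrderedCommutativeRing._≤_ R (OrderedCommutativeRing.0# R) q →
    OrderedCommutativeRing._≤_ R q (OrderedCommutativeRing.1# R) →
    IsGenPermParams R (suc n) (liftParams R q z)
proposition2p4 R n z (z⊥≈0 , supermodular) (_ , monotone) q 0≤q q≤1 =
  lift-⊥ , lift-supermodular
  where
  open OrderedCommutativeRing R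

  z′ : Params R (suc n)
  z′ = liftParams R q z

  lift-⊥ : z′ ⊥ ≈ 0#
  lift-⊥ rewrite liftParams≡scaleBy R q z ⊥ | lastS-⊥ n | initS-⊥ n =
    trans (*-congˡ z⊥≈0) (zeroʳ q)

  lift-supermodular : ∀ I J → z′ I + z′ J ≤ z′ (I ∪ J) + z′ (I ∩ J)
  lift-supermodular I J
    rewrite liftParams≡scaleBy R q z I | liftParams≡scaleBy R q z J
          | liftParams≡scaleBy R q z (I ∪ J) | liftParams≡scaleBy R q z (I ∩ J)
          | lastS-∪ I J | lastS-∩ I J | initS-∪ I J | initS-∩ I J =
    scaleBy-supermodular R 0≤q q≤1 (supermodular I′ J′)
      (monotone _ _ (p∩q⊆p I′ J′)) (monotone _ _ (p∩q⊆q I′ J′)) (lastS I) (lastS J)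
    where
    I′ J′ : Subset n
    I′ = initS I
    J′ = initS J
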